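{- The permutation statistic $(a-cb)+(b-ca)+(b-ca)+(ba)$ (in which the pattern $b-ca$ is counted twice) is Mahonian; that is, for every $n\ge1$ and every integer $k$, the number of $\pi\in\mathfrak S_n$ with $(a-cb)\,\pi+2\,(b-ca)\,\pi+(ba)\,\pi=k$ equals the number of $\pi\in\mathfrak S_n$ with $\mathrm{inv}\,\pi=k$.
   Context: $\mathfrak S_n$ is the set of permutations $\pi=\pi_1\cdots\pi_n$ of $\{1,\dots,n\}$; $\mathrm{inv}\,\pi=\#\{(i,j):1\le i<j\le n,\ \pi_i>\pi_j\}$. Vincular pattern counts: $(a-cb)\,\pi=\#\{(i,j):i<j<n,\ \pi_i<\pi_{j+1}<\pi_j\}$; $(b-ca)\,\pi=\#\{(i,j):i<j<n,\ \pi_{j+1}<\pi_i<\pi_j\}$; $(ba)\,\pi=\#\{i<n:\pi_i>\pi_{i+1}\}$. A sum of patterns denotes the sum of their counts (with multiplicity). -}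

module Defs where

open import Data.Nat using (ℕ; zero; suc; _+_; _<ᵇ_)
open import Data.Bool using (Bool; true; false; _∧_; not; T)
open import Data.Fin using (Fin; toℕ)
open import Data.Fin.Properties using (_≟_)
open import Data.Vec using (Vec; []; _∷_)
open import Relation.Nullary.Decidable using (⌊_⌋)

-- A word of length n over {0,…,n-1}; entries compared via toℕ.
-- (Values 0..n-1 instead of 1..n: order-isomorphic, all statistics unchanged.)

elemᵇ : ∀ {n m} → Fin n → Vec (Fin n) m → Bool
elemᵇ x [] = false
elemᵇ x (y ∷ ys) = ⌊ x ≟ y ⌋ Data.Bool.∨ elemᵇ x ys

-- all entries distinct; a length-n word over an n-element alphabet with
-- distinct entries is exactly a permutation (one-line notation).
distinctᵇ : ∀ {n m} → Vec (Fin n) m → Bool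
distinctᵇ [] = true
distinctᵇ (x ∷ xs) = not (elemᵇ x xs) ∧ distinctᵇ xs

-- The symmetric group S_n as one-line words; T (…) is proof-irrelevant.
record Perm (n : ℕ) : Set where
  constructor perm
  field
    word     : Vec (Fin n) n
    isPerm   : T (distinctᵇ word)
open Perm public

private
  _<_ : ∀ {n} → Fin n → Fin n → Bool
  a < b = toℕ a <ᵇ toℕ b

  count : Bool → ℕ
  count true = 1
  count false = 0

greaterThan : ∀ {n m} → Fin n → Vec (Fin n) m → ℕ
greaterThan x [] = 0
greaterThan x (y ∷ ys) = count (y < x) + greaterThan x ys

invW : ∀ {n m} → Vec (Fin n) m → ℕ
invW [] = 0
invW (x ∷ xs) = greaterThan x xs + invW xs

-- For a fixed first letter x = π_i and the suffix after it, count the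
-- adjacent pairs (π_j, π_{j+1}) in the suffix with P x π_j π_{j+1}.
adjCount : ∀ {n m} → (Fin n → Fin n → Fin n → Bool) → Fin n → Vec (Fin n) m → ℕ
adjCount P x [] = 0
adjCount P x (y ∷ []) = 0
adjCount P x (y ∷ z ∷ zs) = count (P x y z) + adjCount P x (z ∷ zs)

vinc : ∀ {n m} → (Fin n → Fin n → Fin n → Bool) → Vec (Fin n) m → ℕ
vinc P [] = 0
vinc P (x ∷ xs) = adjCount P x xs + vinc P xs

a-cbW : ∀ {n m} → Vec (Fin n) m → ℕ
a-cbW = vinc (λ x y z → (x < z) ∧ (z < y))

b-caW : ∀ {n m} → Vec (Fin n) m → ℕ
b-caW = vinc (λ x y z → (z < x) ∧ (x < y))

baW : ∀ {n m} → Vec (Fin n) m → ℕ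
baW [] = 0
baW (x ∷ []) = 0
baW (x ∷ y ∷ ys) = count (y < x) + baW (y ∷ ys)

inv a-cb b-ca ba : ∀ {n} → Perm n → ℕ
inv π = invW (word π)
a-cb π = a-cbW (word π)
b-ca π = b-caW (word π)
ba π = baW (word π)

stat : ∀ {n} → Perm n → ℕ
stat π = a-cb π + b-ca π + b-ca π + ba π

-- A permutation is determined by its last letter g and the standardisation of the other
-- letters, so permutations of length n are coded by sequences g₁ … gₙ with gᵢ < i. Appending
-- g to a permutation of length m adds m − g inversions; it adds to the statistic an amount
-- depending only on g and the previous code letter r: nothing if the new last pair is an
-- ascent (r < g), and otherwise g occurrences of a-cb, r − g of b-ca and one descent.
-- Let flip_g reverse 0, …, g − 1 and fix the larger letters. Replacing every code letter r,
-- followed by g, by the letter whose inversion contribution is flip_g r gives a bijection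
-- of codes, and the identity  flip_g r + (m + 1 − g) = (m − r) + increment(r, g)  makes the
-- inversion count of the new code telescope to the statistic of the old one.

module Submission where

open import Defs
open import Data.Bool using (Bool; true; false; _∧_; _∨_; not; T; if_then_else_)
open import Data.Bool.Properties
  using (∧-zeroʳ; ∧-identityʳ; ∨-identityʳ; ∨-assoc; T-irrelevant; T-∧; T-not-≡; T-≡)
open import Data.Empty using (⊥-elim)
open import Data.Fin using (Fin; toℕ; punchIn; punchOut; fromℕ<; opposite) renaming (zero to fzero; suc to fsuc)
open import Data.Fin.Properties
  using (_≟_; punchIn-injective; punchInᵢ≢i; punchIn-punchOut; toℕ<n; toℕ≤pred[n]; toℕ-fromℕ<; toℕ-injective;
         opposite-prop; opposite-involutive)
open import Data.Nat using (ℕ; zero; suc; _+_; _∸_; _≤_; _<_; _≥_; _<ᵇ_; z≤n; s≤s; _<?_; _≤?_)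
open import Data.Nat.Properties
  using (+-identityʳ; +-assoc; +-comm; +-suc; +-commutativeSemigroup; ≤-refl; ≤-trans; ≤-pred; <⇒≤; ≮⇒≥; ≰⇒>;
         <-≤-trans; <ᵇ⇒<; <⇒<ᵇ; ∸-monoʳ-<; m∸[m∸n]≡n; m+n∸m≡n; m+n∸n≡m; m+[n∸m]≡n; m≤n⇒∃[o]m+o≡n;
         suc-injective; ≡-irrelevant)
open import Algebra.Properties.CommutativeSemigroup +-commutativeSemigroup using (interchange)
open import Data.Nat.Solver using (module +-*-Solver)
open import Data.Product using (Σ; _×_; _,_; proj₁; proj₂)
open import Data.Product.Function.Dependent.Propositional using (Σ-↔)
open import Data.Unit using (tt)
open import Data.Vec using (Vec; []; _∷_; _∷ʳ_; map; init; last; initLast)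
open import Data.Vec.Properties using (map-∷ʳ; ∷ʳ-injective; ∷-injective; last-∷ʳ)
open import Function using (_∘_)
open import Function.Bundles using (_↔_; mk↔ₛ′; Equivalence; Inverse)
open import Function.Properties.Inverse using (↔-trans; ↔-sym)
open import Relation.Binary.PropositionalEquality
open import Relation.Nullary using (Dec; yes; no; ¬_)
open import Relation.Nullary.Decidable using (⌊_⌋)

_<ᶠ_ : ∀ {n} → Fin n → Fin n → Bool
a <ᶠ b = toℕ a <ᵇ toℕ b

𝟙 : Bool → ℕ
𝟙 true = 1
𝟙 false = 0

≤⇒≮ᵇ : ∀ {m n} → m ≤ n → (n <ᵇ m) ≡ false
≤⇒≮ᵇ z≤n = refl
≤⇒≮ᵇ (s≤s m≤n) = ≤⇒≮ᵇ m≤n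

<⇒<ᵇ≡true : ∀ {m n} → m < n → (m <ᵇ n) ≡ true
<⇒<ᵇ≡true m<n = Equivalence.to T-≡ (<⇒<ᵇ m<n)

countᵇ : ∀ {A : Set} {m} → (A → Bool) → Vec A m → ℕ
countᵇ p [] = 0
countᵇ p (x ∷ xs) = 𝟙 (p x) + countᵇ p xs

acb bca : ∀ {n} → Fin n → Fin n → Fin n → Bool
acb x y z = (x <ᶠ z) ∧ (z <ᶠ y)
bca x y z = (z <ᶠ x) ∧ (x <ᶠ y)

statW : ∀ {n m} → Vec (Fin n) m → ℕ
statW w = a-cbW w + b-caW w + b-caW w + baW w

module _ {A : Set} where

  countᵇ-∷ʳ : ∀ {m} p (xs : Vec A m) z → countᵇ p (xs ∷ʳ z) ≡ countᵇ p xs + 𝟙 (p z)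
  countᵇ-∷ʳ p [] z = +-comm (𝟙 (p z)) 0
  countᵇ-∷ʳ p (x ∷ xs) z = trans (cong (𝟙 (p x) +_) (countᵇ-∷ʳ p xs z)) (sym (+-assoc (𝟙 (p x)) _ _))

  countᵇ-cong : ∀ {m p q} → (∀ x → p x ≡ q x) → (xs : Vec A m) → countᵇ p xs ≡ countᵇ q xs
  countᵇ-cong p≗q [] = refl
  countᵇ-cong p≗q (x ∷ xs) = cong₂ (λ b k → 𝟙 b + k) (p≗q x) (countᵇ-cong p≗q xs)

  countᵇ-none : ∀ {m p} → (∀ x → p x ≡ false) → (xs : Vec A m) → countᵇ p xs ≡ 0
  countᵇ-none none [] = refl
  countᵇ-none none (x ∷ xs) rewrite none x = countᵇ-none none xs

  countᵇ-+ : ∀ {m p q r} → (∀ x → 𝟙 (p x) + 𝟙 (q x) ≡ 𝟙 (r x)) →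
             (xs : Vec A m) → countᵇ p xs + countᵇ q xs ≡ countᵇ r xs
  countᵇ-+ split [] = refl
  countᵇ-+ {p = p} {q} split (x ∷ xs) =
    trans (interchange (𝟙 (p x)) (countᵇ p xs) (𝟙 (q x)) (countᵇ q xs))
          (cong₂ _+_ (split x) (countᵇ-+ split xs))

  countᵇ-+-not : ∀ {m} p (xs : Vec A m) → countᵇ p xs + countᵇ (not ∘ p) xs ≡ m
  countᵇ-+-not p xs = trans (countᵇ-+ (λ x → 𝟙-+-not (p x)) xs) (countᵇ-true xs)
    where
    𝟙-+-not : ∀ b → 𝟙 b + 𝟙 (not b) ≡ 𝟙 true
    𝟙-+-not true = refl
    𝟙-+-not false = refl
    countᵇ-true : ∀ {m} (xs : Vec A m) → countᵇ (λ _ → true) xs ≡ m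
    countᵇ-true [] = refl
    countᵇ-true (x ∷ xs) = cong suc (countᵇ-true xs)

countᵇ-map : ∀ {A B : Set} {m} (f : A → B) {p q} → (∀ x → p (f x) ≡ q x) →
             (xs : Vec A m) → countᵇ p (map f xs) ≡ countᵇ q xs
countᵇ-map f p∘f≗q [] = refl
countᵇ-map f p∘f≗q (x ∷ xs) = cong₂ (λ b k → 𝟙 b + k) (p∘f≗q x) (countᵇ-map f p∘f≗q xs)

pairCount : ∀ {A : Set} {m} → (A → A → Bool) → Vec A m → ℕ
pairCount Q [] = 0
pairCount Q (y ∷ []) = 0
pairCount Q (y ∷ z ∷ zs) = 𝟙 (Q y z) + pairCount Q (z ∷ zs)

pairCount-∷ʳ : ∀ {A : Set} {m} Q (ys : Vec A m) y z →
               pairCount Q ((ys ∷ʳ y) ∷ʳ z) ≡ pairCount Q (ys ∷ʳ y) + 𝟙 (Q y z)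
pairCount-∷ʳ Q [] y z = +-comm (𝟙 (Q y z)) 0
pairCount-∷ʳ Q (a ∷ []) y z =
  trans (cong (𝟙 (Q a y) +_) (+-comm (𝟙 (Q y z)) 0)) (sym (+-assoc (𝟙 (Q a y)) 0 _))
pairCount-∷ʳ Q (a ∷ b ∷ bs) y z =
  trans (cong (𝟙 (Q a b) +_) (pairCount-∷ʳ Q (b ∷ bs) y z)) (sym (+-assoc (𝟙 (Q a b)) _ _))

pairCount-map : ∀ {A B : Set} {m} (f : A → B) {Q Q'} → (∀ a b → Q (f a) (f b) ≡ Q' a b) →
                (ys : Vec A m) → pairCount Q (map f ys) ≡ pairCount Q' ys
pairCount-map f Q∘f≗Q' [] = refl
pairCount-map f Q∘f≗Q' (y ∷ []) = refl
pairCount-map f Q∘f≗Q' (y ∷ z ∷ zs) = cong₂ (λ b k → 𝟙 b + k) (Q∘f≗Q' y z) (pairCount-map f Q∘f≗Q' (z ∷ zs))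

-- Defs counts with a private function, so its statistics are matched with countᵇ and
-- pairCount one letter at a time.
module _ {n : ℕ} where

  greaterThan≡countᵇ : ∀ {m} (x : Fin n) (ys : Vec (Fin n) m) → greaterThan x ys ≡ countᵇ (_<ᶠ x) ys
  greaterThan≡countᵇ x [] = refl
  greaterThan≡countᵇ x (y ∷ ys) with y <ᶠ x | greaterThan≡countᵇ x ys
  ... | true  | ih = cong suc ih
  ... | false | ih = ih

  adjCount≡pairCount : ∀ {m} P (x : Fin n) (ys : Vec (Fin n) m) → adjCount P x ys ≡ pairCount (P x) ys
  adjCount≡pairCount P x [] = refl
  adjCount≡pairCount P x (y ∷ []) = refl
  adjCount≡pairCount P x (y ∷ z ∷ zs) with P x y z | adjCount≡pairCount P x (z ∷ zs)
  ... | true  | ih = cong suc ih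
  ... | false | ih = ih

  baW≡pairCount : ∀ {m} (ys : Vec (Fin n) m) → baW ys ≡ pairCount (λ y z → z <ᶠ y) ys
  baW≡pairCount [] = refl
  baW≡pairCount (y ∷ []) = refl
  baW≡pairCount (y ∷ z ∷ zs) with z <ᶠ y | baW≡pairCount (z ∷ zs)
  ... | true  | ih = cong suc ih
  ... | false | ih = ih

  invW-∷ʳ : ∀ {m} (xs : Vec (Fin n) m) z → invW (xs ∷ʳ z) ≡ invW xs + countᵇ (z <ᶠ_) xs
  invW-∷ʳ [] z = refl
  invW-∷ʳ (x ∷ xs) z = begin
    greaterThan x (xs ∷ʳ z) + invW (xs ∷ʳ z)
      ≡⟨ cong₂ _+_ (trans (greaterThan≡countᵇ x (xs ∷ʳ z)) (countᵇ-∷ʳ (_<ᶠ x) xs z)) (invW-∷ʳ xs z) ⟩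
    countᵇ (_<ᶠ x) xs + 𝟙 (z <ᶠ x) + (invW xs + countᵇ (z <ᶠ_) xs)
      ≡⟨ interchange (countᵇ (_<ᶠ x) xs) _ _ _ ⟩
    countᵇ (_<ᶠ x) xs + invW xs + countᵇ (z <ᶠ_) (x ∷ xs)
      ≡⟨ cong (λ k → k + invW xs + countᵇ (z <ᶠ_) (x ∷ xs)) (greaterThan≡countᵇ x xs) ⟨
    invW (x ∷ xs) + countᵇ (z <ᶠ_) (x ∷ xs) ∎
    where open ≡-Reasoning

  adjCount-∷ʳ : ∀ {m} P (x : Fin n) (ys : Vec (Fin n) m) y z →
                adjCount P x ((ys ∷ʳ y) ∷ʳ z) ≡ adjCount P x (ys ∷ʳ y) + 𝟙 (P x y z)
  adjCount-∷ʳ P x ys y z =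
    trans (adjCount≡pairCount P x ((ys ∷ʳ y) ∷ʳ z))
          (trans (pairCount-∷ʳ (P x) ys y z) (cong (_+ _) (sym (adjCount≡pairCount P x (ys ∷ʳ y)))))

  vinc-∷ʳ : ∀ {m} P (ys : Vec (Fin n) m) y z →
            vinc P ((ys ∷ʳ y) ∷ʳ z) ≡ vinc P (ys ∷ʳ y) + countᵇ (λ x → P x y z) ys
  vinc-∷ʳ P [] y z = refl
  vinc-∷ʳ P (a ∷ as) y z =
    trans (cong₂ _+_ (adjCount-∷ʳ P a as y z) (vinc-∷ʳ P as y z))
          (interchange (adjCount P a (as ∷ʳ y)) _ _ _)

  baW-∷ʳ : ∀ {m} (ys : Vec (Fin n) m) y z → baW ((ys ∷ʳ y) ∷ʳ z) ≡ baW (ys ∷ʳ y) + 𝟙 (z <ᶠ y)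
  baW-∷ʳ ys y z =
    trans (baW≡pairCount ((ys ∷ʳ y) ∷ʳ z))
          (trans (pairCount-∷ʳ _ ys y z) (cong (_+ _) (sym (baW≡pairCount (ys ∷ʳ y)))))

  lastPairStat : ∀ {m} → Vec (Fin n) m → Fin n → Fin n → ℕ
  lastPairStat ys y z = countᵇ (λ x → acb x y z) ys + countᵇ (λ x → bca x y z) ys
                      + countᵇ (λ x → bca x y z) ys + 𝟙 (z <ᶠ y)

  statW-∷ʳ : ∀ {m} (ys : Vec (Fin n) m) y z → statW ((ys ∷ʳ y) ∷ʳ z) ≡ statW (ys ∷ʳ y) + lastPairStat ys y z
  statW-∷ʳ ys y z rewrite vinc-∷ʳ acb ys y z | vinc-∷ʳ bca ys y z | baW-∷ʳ ys y z =
    solve 6 (λ a a' b b' d d' → a :+ a' :+ (b :+ b') :+ (b :+ b') :+ (d :+ d')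
                                := a :+ b :+ b :+ d :+ (a' :+ b' :+ b' :+ d'))
            refl (vinc acb (ys ∷ʳ y)) _ (vinc bca (ys ∷ʳ y)) _ (baW (ys ∷ʳ y)) _
    where open +-*-Solver

module _ {n N : ℕ} (f : Fin n → Fin N) (f-mono : ∀ a b → f a <ᶠ f b ≡ a <ᶠ b) where

  invW-map : ∀ {m} (ys : Vec (Fin n) m) → invW (map f ys) ≡ invW ys
  invW-map [] = refl
  invW-map (y ∷ ys) = cong₂ _+_ greaterThan-map (invW-map ys)
    where
    greaterThan-map : greaterThan (f y) (map f ys) ≡ greaterThan y ys
    greaterThan-map = trans (greaterThan≡countᵇ (f y) (map f ys))
                            (trans (countᵇ-map f (λ x → f-mono x y) ys) (sym (greaterThan≡countᵇ y ys)))

  vinc-map : ∀ {m} (P : ∀ {k} → Fin k → Fin k → Fin k → Bool) → (∀ a b c → P (f a) (f b) (f c) ≡ P a b c) →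
             (ys : Vec (Fin n) m) → vinc P (map f ys) ≡ vinc P ys
  vinc-map P P∘f≗P [] = refl
  vinc-map P P∘f≗P (y ∷ ys) = cong₂ _+_ adjCount-map (vinc-map P P∘f≗P ys)
    where
    adjCount-map : adjCount P (f y) (map f ys) ≡ adjCount P y ys
    adjCount-map = trans (adjCount≡pairCount P (f y) (map f ys))
                         (trans (pairCount-map f (P∘f≗P y) ys) (sym (adjCount≡pairCount P y ys)))

  statW-map : ∀ {m} (ys : Vec (Fin n) m) → statW (map f ys) ≡ statW ys
  statW-map ys = cong₂ _+_ (cong₂ _+_ (cong₂ _+_ (vinc-map acb acb-map ys) b-caW-map) b-caW-map) baW-map
    where
    acb-map : ∀ a b c → acb (f a) (f b) (f c) ≡ acb a b c
    acb-map a b c = cong₂ _∧_ (f-mono a c) (f-mono c b)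
    bca-map : ∀ a b c → bca (f a) (f b) (f c) ≡ bca a b c
    bca-map a b c = cong₂ _∧_ (f-mono c a) (f-mono a b)
    b-caW-map : b-caW (map f ys) ≡ b-caW ys
    b-caW-map = vinc-map bca bca-map ys
    baW-map : baW (map f ys) ≡ baW ys
    baW-map = trans (baW≡pairCount (map f ys))
                    (trans (pairCount-map f (λ a b → f-mono b a) ys) (sym (baW≡pairCount ys)))

punchIn-<ᶠ : ∀ {n} (g : Fin (suc n)) a b → punchIn g a <ᶠ punchIn g b ≡ a <ᶠ b
punchIn-<ᶠ fzero a b = refl
punchIn-<ᶠ (fsuc g) fzero fzero = refl
punchIn-<ᶠ (fsuc g) fzero (fsuc b) = refl
punchIn-<ᶠ (fsuc g) (fsuc a) fzero = refl
punchIn-<ᶠ {suc n} (fsuc g) (fsuc a) (fsuc b) = punchIn-<ᶠ {n} g a b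

<ᶠ-punchIn : ∀ {n} (g : Fin (suc n)) x → g <ᶠ punchIn g x ≡ not (toℕ x <ᵇ toℕ g)
<ᶠ-punchIn fzero x = refl
<ᶠ-punchIn (fsuc g) fzero = refl
<ᶠ-punchIn (fsuc g) (fsuc x) = <ᶠ-punchIn g x

toℕ-punchIn-≮ : ∀ {n} (g : Fin (suc n)) x → (toℕ x <ᵇ toℕ g) ≡ false → toℕ (punchIn g x) ≡ suc (toℕ x)
toℕ-punchIn-≮ fzero x _ = refl
toℕ-punchIn-≮ (fsuc g) (fsuc x) x≮g = cong suc (toℕ-punchIn-≮ g x x≮g)

punchIn-<ᵇ-≤ : ∀ {n} (g : Fin (suc n)) x t → t ≤ toℕ g → (toℕ (punchIn g x) <ᵇ t) ≡ (toℕ x <ᵇ t)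
punchIn-<ᵇ-≤ fzero x zero _ = refl
punchIn-<ᵇ-≤ (fsuc g) fzero t _ = refl
punchIn-<ᵇ-≤ (fsuc g) (fsuc x) zero _ = refl
punchIn-<ᵇ-≤ (fsuc g) (fsuc x) (suc t) (s≤s t≤g) = punchIn-<ᵇ-≤ g x t t≤g

punchIn-<ᵇ-≥ : ∀ {n} (g : Fin (suc n)) x t → toℕ g ≤ t → (toℕ (punchIn g x) <ᵇ suc t) ≡ (toℕ x <ᵇ t)
punchIn-<ᵇ-≥ fzero x t _ = refl
punchIn-<ᵇ-≥ (fsuc g) fzero (suc t) _ = refl
punchIn-<ᵇ-≥ (fsuc g) (fsuc x) (suc t) (s≤s g≤t) = punchIn-<ᵇ-≥ g x t g≤t

⌊≟⌋-sym : ∀ {n} (x z : Fin n) → ⌊ x ≟ z ⌋ ≡ ⌊ z ≟ x ⌋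
⌊≟⌋-sym x z with x ≟ z | z ≟ x
... | yes _   | yes _   = refl
... | no _    | no _    = refl
... | yes x≡z | no z≢x  = ⊥-elim (z≢x (sym x≡z))
... | no x≢z  | yes z≡x = ⊥-elim (x≢z (sym z≡x))

elemᵇ-∷ʳ : ∀ {n m} (x : Fin n) (xs : Vec (Fin n) m) z → elemᵇ x (xs ∷ʳ z) ≡ elemᵇ x xs ∨ ⌊ x ≟ z ⌋
elemᵇ-∷ʳ x [] z = ∨-identityʳ _
elemᵇ-∷ʳ x (y ∷ xs) z = trans (cong (⌊ x ≟ y ⌋ ∨_) (elemᵇ-∷ʳ x xs z)) (sym (∨-assoc ⌊ x ≟ y ⌋ (elemᵇ x xs) _))

distinctᵇ-∷ʳ : ∀ {n m} (xs : Vec (Fin n) m) z → distinctᵇ (xs ∷ʳ z) ≡ distinctᵇ xs ∧ not (elemᵇ z xs)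
distinctᵇ-∷ʳ [] z = refl
distinctᵇ-∷ʳ (x ∷ xs) z rewrite elemᵇ-∷ʳ x xs z | distinctᵇ-∷ʳ xs z | ⌊≟⌋-sym x z =
  reassoc (elemᵇ x xs) ⌊ z ≟ x ⌋ (distinctᵇ xs) (elemᵇ z xs)
  where
  reassoc : ∀ e c d f → not (e ∨ c) ∧ (d ∧ not f) ≡ (not e ∧ d) ∧ not (c ∨ f)
  reassoc true c d f = refl
  reassoc false true d f = sym (∧-zeroʳ d)
  reassoc false false d f = refl

module _ {n N : ℕ} (f : Fin n → Fin N) (f-inj : ∀ a b → f a ≡ f b → a ≡ b) where

  ⌊≟⌋-injective : ∀ x y → ⌊ f x ≟ f y ⌋ ≡ ⌊ x ≟ y ⌋
  ⌊≟⌋-injective x y with f x ≟ f y | x ≟ y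
  ... | yes _     | yes _   = refl
  ... | no _      | no _    = refl
  ... | yes fx≡fy | no x≢y  = ⊥-elim (x≢y (f-inj x y fx≡fy))
  ... | no fx≢fy  | yes x≡y = ⊥-elim (fx≢fy (cong f x≡y))

  elemᵇ-map : ∀ {m} x (ys : Vec (Fin n) m) → elemᵇ (f x) (map f ys) ≡ elemᵇ x ys
  elemᵇ-map x [] = refl
  elemᵇ-map x (y ∷ ys) = cong₂ _∨_ (⌊≟⌋-injective x y) (elemᵇ-map x ys)

  distinctᵇ-map : ∀ {m} (ys : Vec (Fin n) m) → distinctᵇ (map f ys) ≡ distinctᵇ ys
  distinctᵇ-map [] = refl
  distinctᵇ-map (y ∷ ys) = cong₂ (λ e d → not e ∧ d) (elemᵇ-map y ys) (distinctᵇ-map ys)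

  map-injective : ∀ {m} (xs ys : Vec (Fin n) m) → map f xs ≡ map f ys → xs ≡ ys
  map-injective [] [] _ = refl
  map-injective (x ∷ xs) (y ∷ ys) eq with ∷-injective eq
  ... | fx≡fy , eq′ = cong₂ _∷_ (f-inj x y fx≡fy) (map-injective xs ys eq′)

elemᵇ-punchIn : ∀ {n m} (g : Fin (suc n)) (ys : Vec (Fin n) m) → elemᵇ g (map (punchIn g) ys) ≡ false
elemᵇ-punchIn g [] = refl
elemᵇ-punchIn g (y ∷ ys) with g ≟ punchIn g y
... | yes g≡ = ⊥-elim (punchInᵢ≢i g y (sym g≡))
... | no _ = elemᵇ-punchIn g ys

punchOutAll : ∀ {n m} (g : Fin (suc n)) (xs : Vec (Fin (suc n)) m) → elemᵇ g xs ≡ false → Vec (Fin n) m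
punchOutAll g [] _ = []
punchOutAll g (x ∷ xs) g∉ with g ≟ x
... | no g≢x = punchOut g≢x ∷ punchOutAll g xs g∉

map-punchIn-punchOutAll : ∀ {n m} (g : Fin (suc n)) (xs : Vec (Fin (suc n)) m) g∉ →
                          map (punchIn g) (punchOutAll g xs g∉) ≡ xs
map-punchIn-punchOutAll g [] _ = refl
map-punchIn-punchOutAll g (x ∷ xs) g∉ with g ≟ x
... | no g≢x = cong₂ _∷_ (punchIn-punchOut g≢x) (map-punchIn-punchOutAll g xs g∉)

Perm-≡ : ∀ {n} {π σ : Perm n} → word π ≡ word σ → π ≡ σ
Perm-≡ {π = perm w p} {perm .w q} refl = cong (perm w) (T-irrelevant p q)

appendWord : ∀ {n m} → Vec (Fin n) m → Fin (suc n) → Vec (Fin (suc n)) (suc m)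
appendWord u g = map (punchIn g) u ∷ʳ g

appendPerm : ∀ {n} → Perm n → Fin (suc n) → Perm (suc n)
appendPerm σ g = perm (appendWord (word σ) g) (subst T (sym distinct) (isPerm σ))
  where
  distinct : distinctᵇ (appendWord (word σ) g) ≡ distinctᵇ (word σ)
  distinct rewrite distinctᵇ-∷ʳ (map (punchIn g) (word σ)) g
                 | distinctᵇ-map (punchIn g) (punchIn-injective g) (word σ)
                 | elemᵇ-punchIn g (word σ) = ∧-identityʳ _

lastLetter : ∀ {n} → Perm (suc n) → Fin (suc n)
lastLetter π = last (word π)

removeLast : ∀ {n} → Perm (suc n) → Perm n
removeLast π = perm (punchOutAll g (init w) g∉) (subst T distinct (proj₁ parts))
  where
  w = word π
  g = last w
  parts : T (distinctᵇ (init w)) × T (not (elemᵇ g (init w)))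
  parts = Equivalence.to T-∧ (subst T (distinctᵇ-∷ʳ (init w) g)
                                      (subst (T ∘ distinctᵇ) (proj₂ (proj₂ (initLast w))) (isPerm π)))
  g∉ : elemᵇ g (init w) ≡ false
  g∉ = Equivalence.to T-not-≡ (proj₂ parts)
  distinct : distinctᵇ (init w) ≡ distinctᵇ (punchOutAll g (init w) g∉)
  distinct = trans (cong distinctᵇ (sym (map-punchIn-punchOutAll g (init w) g∉)))
                   (distinctᵇ-map (punchIn g) (punchIn-injective g) (punchOutAll g (init w) g∉))

appendPerm-removeLast : ∀ {n} (π : Perm (suc n)) → appendPerm (removeLast π) (lastLetter π) ≡ π
appendPerm-removeLast π = Perm-≡ (trans (cong (_∷ʳ last (word π)) (map-punchIn-punchOutAll _ _ _))
                                        (sym (proj₂ (proj₂ (initLast (word π))))))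

lastLetter-appendPerm : ∀ {n} (σ : Perm n) g → lastLetter (appendPerm σ g) ≡ g
lastLetter-appendPerm σ g = last-∷ʳ g (map (punchIn g) (word σ))

removeLast-appendPerm : ∀ {n} (σ : Perm n) g → removeLast (appendPerm σ g) ≡ σ
removeLast-appendPerm σ g = Perm-≡ (map-injective (punchIn g) (punchIn-injective g) _ (word σ) prefix≡)
  where
  π = appendPerm σ g
  prefix≡ : map (punchIn g) (word (removeLast π)) ≡ map (punchIn g) (word σ)
  prefix≡ = subst (λ h → map (punchIn h) (word (removeLast π)) ≡ map (punchIn g) (word σ))
                  (lastLetter-appendPerm σ g)
                  (proj₁ (∷ʳ-injective _ _ (cong word (appendPerm-removeLast π))))

data Code : ℕ → Set where
  ε : Code 0
  _▸_ : ∀ {n} → Code n → Fin (suc n) → Code (suc n)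

encode : ∀ {n} → Code n → Perm n
encode ε = perm [] tt
encode (c ▸ g) = appendPerm (encode c) g

decode : ∀ {n} → Perm n → Code n
decode {zero} _ = ε
decode {suc n} π = decode (removeLast π) ▸ lastLetter π

decode-encode : ∀ {n} (c : Code n) → decode (encode c) ≡ c
decode-encode ε = refl
decode-encode (c ▸ g) = cong₂ _▸_ (trans (cong decode (removeLast-appendPerm (encode c) g)) (decode-encode c))
                                  (lastLetter-appendPerm (encode c) g)

encode-decode : ∀ {n} (π : Perm n) → encode (decode π) ≡ π
encode-decode {zero} (perm [] _) = refl
encode-decode {suc n} π = trans (cong (λ σ → appendPerm σ (lastLetter π)) (encode-decode (removeLast π)))
                                (appendPerm-removeLast π)

Perm↔Code : ∀ {n} → Perm n ↔ Code n
Perm↔Code = mk↔ₛ′ decode encode decode-encode encode-decode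

countBelow : ∀ {n m} → ℕ → Vec (Fin n) m → ℕ
countBelow t = countᵇ (λ x → toℕ x <ᵇ t)

countBelow-encode : ∀ {n} (c : Code n) t → t ≤ n → countBelow t (word (encode c)) ≡ t
countBelow-encode c zero _ = countᵇ-none (λ _ → refl) (word (encode c))
countBelow-encode (c ▸ g) (suc t) t<n with suc t ≤? toℕ g
... | yes t<g = begin
  countBelow (suc t) (appendWord u g)
    ≡⟨ countᵇ-∷ʳ _ (map (punchIn g) u) g ⟩
  countBelow (suc t) (map (punchIn g) u) + 𝟙 (toℕ g <ᵇ suc t)
    ≡⟨ cong₂ _+_ (countᵇ-map (punchIn g) (λ x → punchIn-<ᵇ-≤ g x (suc t) t<g) u) (cong 𝟙 (≤⇒≮ᵇ t<g)) ⟩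
  countBelow (suc t) u + 0
    ≡⟨ +-identityʳ _ ⟩
  countBelow (suc t) u
    ≡⟨ countBelow-encode c (suc t) (≤-trans t<g (toℕ≤pred[n] g)) ⟩
  suc t ∎
  where open ≡-Reasoning
        u = word (encode c)
... | no t≮g = begin
  countBelow (suc t) (appendWord u g)
    ≡⟨ countᵇ-∷ʳ _ (map (punchIn g) u) g ⟩
  countBelow (suc t) (map (punchIn g) u) + 𝟙 (toℕ g <ᵇ suc t)
    ≡⟨ cong₂ _+_ (countᵇ-map (punchIn g) (λ x → punchIn-<ᵇ-≥ g x t g≤t) u) (cong 𝟙 (<⇒<ᵇ≡true (s≤s g≤t))) ⟩
  countBelow t u + 1
    ≡⟨ cong (_+ 1) (countBelow-encode c t (≤-pred t<n)) ⟩
  t + 1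
    ≡⟨ +-comm t 1 ⟩
  suc t ∎
  where open ≡-Reasoning
        u = word (encode c)
        g≤t = ≤-pred (≰⇒> t≮g)

invC : ∀ {n} → Code n → ℕ
invC ε = 0
invC (c ▸ g) = invC c + toℕ (opposite g)

invW-encode : ∀ {n} (c : Code n) → invW (word (encode c)) ≡ invC c
invW-encode ε = refl
invW-encode (_▸_ {m} c g) = begin
  invW (appendWord u g)
    ≡⟨ invW-∷ʳ (map (punchIn g) u) g ⟩
  invW (map (punchIn g) u) + countᵇ (g <ᶠ_) (map (punchIn g) u)
    ≡⟨ cong₂ _+_ (invW-map (punchIn g) (punchIn-<ᶠ g) u) (countᵇ-map (punchIn g) (<ᶠ-punchIn g) u) ⟩
  invW u + countᵇ (not ∘ below) u
    ≡⟨ cong₂ _+_ (invW-encode c) notBelow ⟩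
  invC c + toℕ (opposite g) ∎
  where
  open ≡-Reasoning
  u = word (encode c)
  below : Fin m → Bool
  below x = toℕ x <ᵇ toℕ g
  notBelow : countᵇ (not ∘ below) u ≡ toℕ (opposite g)
  notBelow = begin
    countᵇ (not ∘ below) u
      ≡⟨ m+n∸m≡n (toℕ g) _ ⟨
    toℕ g + countᵇ (not ∘ below) u ∸ toℕ g
      ≡⟨ cong (λ k → k + countᵇ (not ∘ below) u ∸ toℕ g) (countBelow-encode c (toℕ g) (toℕ≤pred[n] g)) ⟨
    countᵇ below u + countᵇ (not ∘ below) u ∸ toℕ g
      ≡⟨ cong (_∸ toℕ g) (countᵇ-+-not below u) ⟩
    m ∸ toℕ g
      ≡⟨ opposite-prop g ⟨
    toℕ (opposite g) ∎

between≡false : ∀ z x y → (z <ᵇ y) ≡ false → ((z <ᵇ x) ∧ (x <ᵇ y)) ≡ false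
between≡false z x zero _ = ∧-zeroʳ _
between≡false z zero (suc y) _ = refl
between≡false (suc z) (suc x) (suc y) z≮y = between≡false z x y z≮y

𝟙-between : ∀ x z y → (z <ᵇ y) ≡ true → 𝟙 ((z <ᵇ x) ∧ (x <ᵇ y)) + 𝟙 (x <ᵇ suc z) ≡ 𝟙 (x <ᵇ y)
𝟙-between zero z (suc y) _ = refl
𝟙-between (suc x) zero (suc y) _ = +-identityʳ _
𝟙-between (suc x) (suc z) (suc y) z<y = 𝟙-between x z y z<y

module _ {N m : ℕ} (ys : Vec (Fin N) m) (y z : Fin N) where

  lastPairStat-ascent : (z <ᶠ y) ≡ false → lastPairStat ys y z ≡ 0
  lastPairStat-ascent z≮y
    rewrite countᵇ-none (λ x → trans (cong ((x <ᶠ z) ∧_) z≮y) (∧-zeroʳ _)) ys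
          | countᵇ-none (λ x → between≡false (toℕ z) (toℕ x) (toℕ y) z≮y) ys
          | z≮y = refl

  -- The full word has exactly t letters below each t; this determines how many letters of
  -- ys lie below z (occurrences of a-cb) and strictly between z and y (of b-ca).
  module _ (z<ᶠy : (z <ᶠ y) ≡ true) (allBelow : ∀ t → t ≤ N → countBelow t ((ys ∷ʳ y) ∷ʳ z) ≡ t) where

    private
      Y = toℕ y
      Z = toℕ z
      Z<Y : Z < Y
      Z<Y = <ᵇ⇒< Z Y (subst T (sym z<ᶠy) tt)

    countBelow-prefix : ∀ t → t ≤ toℕ y → countBelow t ys + 𝟙 (toℕ z <ᵇ t) ≡ t
    countBelow-prefix t t≤Y = begin
      countBelow t ys + 𝟙 (Z <ᵇ t)
        ≡⟨ cong (_+ 𝟙 (Z <ᵇ t)) (+-identityʳ _) ⟨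
      countBelow t ys + 0 + 𝟙 (Z <ᵇ t)
        ≡⟨ cong (λ b → countBelow t ys + 𝟙 b + 𝟙 (Z <ᵇ t)) (≤⇒≮ᵇ t≤Y) ⟨
      countBelow t ys + 𝟙 (Y <ᵇ t) + 𝟙 (Z <ᵇ t)
        ≡⟨ trans (countᵇ-∷ʳ _ (ys ∷ʳ y) z) (cong (_+ 𝟙 (Z <ᵇ t)) (countᵇ-∷ʳ _ ys y)) ⟨
      countBelow t ((ys ∷ʳ y) ∷ʳ z)
        ≡⟨ allBelow t (≤-trans t≤Y (<⇒≤ (toℕ<n y))) ⟩
      t ∎
      where open ≡-Reasoning

    countᵇ-acb : countᵇ (λ x → acb x y z) ys ≡ toℕ z
    countᵇ-acb = begin
      countᵇ (λ x → acb x y z) ys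
        ≡⟨ countᵇ-cong (λ x → trans (cong ((x <ᶠ z) ∧_) z<ᶠy) (∧-identityʳ _)) ys ⟩
      countBelow Z ys
        ≡⟨ +-identityʳ _ ⟨
      countBelow Z ys + 0
        ≡⟨ cong (λ b → countBelow Z ys + 𝟙 b) (≤⇒≮ᵇ (≤-refl {Z})) ⟨
      countBelow Z ys + 𝟙 (Z <ᵇ Z)
        ≡⟨ countBelow-prefix Z (<⇒≤ Z<Y) ⟩
      Z ∎
      where open ≡-Reasoning

    countᵇ-bca : countᵇ (λ x → bca x y z) ys + suc (toℕ z) ≡ toℕ y
    countᵇ-bca = begin
      B + suc Z
        ≡⟨ cong (λ k → B + suc k) (suc-injective (countBelow-above (suc Z) ≤-refl Z<Y)) ⟨
      B + suc (countBelow (suc Z) ys)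
        ≡⟨ +-suc B _ ⟩
      suc (B + countBelow (suc Z) ys)
        ≡⟨ cong suc (countᵇ-+ (λ x → 𝟙-between (toℕ x) Z Y z<ᶠy) ys) ⟩
      suc (countBelow Y ys)
        ≡⟨ countBelow-above Y Z<Y ≤-refl ⟩
      Y ∎
      where
      open ≡-Reasoning
      B = countᵇ (λ x → bca x y z) ys
      countBelow-above : ∀ t → Z < t → t ≤ Y → suc (countBelow t ys) ≡ t
      countBelow-above t Z<t t≤Y =
        trans (+-comm 1 _) (trans (cong (λ b → countBelow t ys + 𝟙 b) (sym (<⇒<ᵇ≡true Z<t))) (countBelow-prefix t t≤Y))

    lastPairStat-descent : lastPairStat ys y z ≡ toℕ y + (toℕ y ∸ suc (toℕ z))
    lastPairStat-descent = begin
      lastPairStat ys y z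
        ≡⟨ cong₂ (λ a b → a + B + B + 𝟙 b) countᵇ-acb z<ᶠy ⟩
      Z + B + B + 1
        ≡⟨ solve 2 (λ Z B → Z :+ B :+ B :+ con 1 := B :+ (con 1 :+ Z) :+ B) refl Z B ⟩
      B + suc Z + B
        ≡⟨ cong₂ _+_ countᵇ-bca (trans (sym (m+n∸n≡m B (suc Z))) (cong (_∸ suc Z) countᵇ-bca)) ⟩
      Y + (Y ∸ suc Z) ∎
      where
      open ≡-Reasoning
      open +-*-Solver
      B = countᵇ (λ x → bca x y z) ys

statStep : ∀ {n} → Fin (suc n) → Fin (suc (suc n)) → ℕ
statStep r g = if toℕ r <ᵇ toℕ g then 0 else suc (toℕ r + (toℕ r ∸ toℕ g))

statC : ∀ {n} → Code n → ℕ
statC ε = 0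
statC (ε ▸ g) = 0
statC ((c ▸ r) ▸ g) = statC (c ▸ r) + statStep r g

module _ {n} (c : Code n) (r : Fin (suc n)) (g : Fin (suc (suc n))) where

  private
    ys = map (punchIn g) (map (punchIn r) (word (encode c)))
    y = punchIn g r

  word-encode-▸▸ : word (encode ((c ▸ r) ▸ g)) ≡ (ys ∷ʳ y) ∷ʳ g
  word-encode-▸▸ = cong (_∷ʳ g) (map-∷ʳ (punchIn g) r (map (punchIn r) (word (encode c))))

  lastPairStat-encode : lastPairStat ys y g ≡ statStep r g
  lastPairStat-encode with toℕ r <ᵇ toℕ g in r<ᵇg
  ... | true = lastPairStat-ascent ys y g (trans (<ᶠ-punchIn g r) (cong not r<ᵇg))
  ... | false = trans (lastPairStat-descent ys y g (trans (<ᶠ-punchIn g r) (cong not r<ᵇg)) allBelow)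
                      (cong (λ k → k + (k ∸ suc (toℕ g))) (toℕ-punchIn-≮ g r r<ᵇg))
    where
    allBelow : ∀ t → t ≤ suc (suc n) → countBelow t ((ys ∷ʳ y) ∷ʳ g) ≡ t
    allBelow t t≤n = trans (cong (countBelow t) (sym word-encode-▸▸)) (countBelow-encode ((c ▸ r) ▸ g) t t≤n)

statW-encode : ∀ {n} (c : Code n) → statW (word (encode c)) ≡ statC c
statW-encode ε = refl
statW-encode (ε ▸ g) = refl
statW-encode ((c ▸ r) ▸ g) = begin
  statW (word (encode ((c ▸ r) ▸ g)))
    ≡⟨ cong statW (word-encode-▸▸ c r g) ⟩
  statW ((ys ∷ʳ y) ∷ʳ g)
    ≡⟨ statW-∷ʳ ys y g ⟩
  statW (ys ∷ʳ y) + lastPairStat ys y g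
    ≡⟨ cong₂ _+_ (trans prefix (statW-encode (c ▸ r))) (lastPairStat-encode c r g) ⟩
  statC (c ▸ r) + statStep r g ∎
  where
  open ≡-Reasoning
  ys = map (punchIn g) (map (punchIn r) (word (encode c)))
  y = punchIn g r
  prefix : statW (ys ∷ʳ y) ≡ statW (word (encode (c ▸ r)))
  prefix = trans (cong statW (sym (map-∷ʳ (punchIn g) r (map (punchIn r) (word (encode c))))))
                 (statW-map (punchIn g) (punchIn-<ᶠ g) (word (encode (c ▸ r))))

flip-opposite-< : ∀ r g n → r < g → g ≤ suc n → (g ∸ suc r) + (suc n ∸ g) ≡ n ∸ r
flip-opposite-< zero (suc g) n _ g≤1+n = m+[n∸m]≡n (≤-pred g≤1+n)
flip-opposite-< (suc r) (suc g) (suc n) (s≤s r<g) (s≤s g≤1+n) = flip-opposite-< r g n r<g g≤1+n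
flip-opposite-< (suc r) (suc zero) zero (s≤s ()) _
flip-opposite-< (suc r) (suc (suc g)) zero _ (s≤s ())

flip-opposite-≥ : ∀ r g n → g ≤ r → r ≤ n → r + (suc n ∸ g) ≡ (n ∸ r) + suc (r + (r ∸ g))
flip-opposite-≥ r g n g≤r r≤n with m≤n⇒∃[o]m+o≡n g≤r | m≤n⇒∃[o]m+o≡n r≤n
... | a , refl | b , refl = begin
  g + a + (suc (g + a + b) ∸ g)        ≡⟨ cong (λ k → g + a + (suc k ∸ g)) (+-assoc g a b) ⟩
  g + a + (suc (g + (a + b)) ∸ g)      ≡⟨ cong (λ k → g + a + (k ∸ g)) (+-suc g (a + b)) ⟨
  g + a + (g + suc (a + b) ∸ g)        ≡⟨ cong (g + a +_) (m+n∸m≡n g (suc (a + b))) ⟩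
  g + a + suc (a + b)                  ≡⟨ solve 3 (λ g a b → g :+ a :+ (con 1 :+ (a :+ b)) := b :+ (con 1 :+ (g :+ a :+ a))) refl g a b ⟩
  b + suc (g + a + a)                  ≡⟨ cong₂ (λ x y → x + suc (g + a + y)) (m+n∸m≡n (g + a) b) (m+n∸m≡n g a) ⟨
  (g + a + b ∸ (g + a)) + suc (g + a + (g + a ∸ g)) ∎
  where open ≡-Reasoning
        open +-*-Solver

∸-suc-involutive : ∀ {r g} → r < g → g ∸ suc (g ∸ suc r) ≡ r
∸-suc-involutive {g = suc g} (s≤s r≤g) = m∸[m∸n]≡n r≤g

flipBelow : ∀ {n} → Fin (suc (suc n)) → Fin (suc n) → Fin (suc n)
flipBelow g r with toℕ r <? toℕ g
... | yes r<g = fromℕ< (<-≤-trans (∸-monoʳ-< (s≤s z≤n) r<g) (toℕ≤pred[n] g))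
... | no _ = r

module _ {n} (g : Fin (suc (suc n))) where

  toℕ-flipBelow-< : ∀ r → toℕ r < toℕ g → toℕ (flipBelow g r) ≡ toℕ g ∸ suc (toℕ r)
  toℕ-flipBelow-< r r<g with toℕ r <? toℕ g
  ... | yes _ = toℕ-fromℕ< _
  ... | no r≮g = ⊥-elim (r≮g r<g)

  flipBelow-≮ : ∀ r → ¬ toℕ r < toℕ g → flipBelow g r ≡ r
  flipBelow-≮ r r≮g with toℕ r <? toℕ g
  ... | yes r<g = ⊥-elim (r≮g r<g)
  ... | no _ = refl

  flipBelow-involutive : ∀ r → flipBelow g (flipBelow g r) ≡ r
  flipBelow-involutive r = by-cases (toℕ r <? toℕ g)
    where
    open ≡-Reasoning
    by-cases : Dec (toℕ r < toℕ g) → flipBelow g (flipBelow g r) ≡ r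
    by-cases (no r≮g) = trans (cong (flipBelow g) (flipBelow-≮ r r≮g)) (flipBelow-≮ r r≮g)
    by-cases (yes r<g) = toℕ-injective (begin
      toℕ (flipBelow g (flipBelow g r))   ≡⟨ toℕ-flipBelow-< (flipBelow g r) s<g ⟩
      toℕ g ∸ suc (toℕ (flipBelow g r))   ≡⟨ cong (λ k → toℕ g ∸ suc k) (toℕ-flipBelow-< r r<g) ⟩
      toℕ g ∸ suc (toℕ g ∸ suc (toℕ r))   ≡⟨ ∸-suc-involutive r<g ⟩
      toℕ r                               ∎)
      where
      s<g : toℕ (flipBelow g r) < toℕ g
      s<g = subst (_< toℕ g) (sym (toℕ-flipBelow-< r r<g)) (∸-monoʳ-< (s≤s z≤n) r<g)

  flipBelow-statStep : ∀ r → toℕ (flipBelow g r) + toℕ (opposite g) ≡ toℕ (opposite r) + statStep r g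
  flipBelow-statStep r rewrite opposite-prop g | opposite-prop r = by-cases (toℕ r <? toℕ g)
    where
    by-cases : Dec (toℕ r < toℕ g) → toℕ (flipBelow g r) + (suc n ∸ toℕ g) ≡ (n ∸ toℕ r) + statStep r g
    by-cases (yes r<g) rewrite toℕ-flipBelow-< r r<g | <⇒<ᵇ≡true r<g =
      trans (flip-opposite-< (toℕ r) (toℕ g) n r<g (toℕ≤pred[n] g)) (sym (+-identityʳ _))
    by-cases (no r≮g) rewrite flipBelow-≮ r r≮g | ≤⇒≮ᵇ (≮⇒≥ r≮g) =
      flip-opposite-≥ (toℕ r) (toℕ g) n (≮⇒≥ r≮g) (toℕ≤pred[n] r)

θ : ∀ {n} → Code n → Fin (suc n) → Code n
θ ε g = ε
θ (c ▸ r) g = θ c r ▸ opposite (flipBelow g r)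

θ⁻¹ : ∀ {n} → Code n → Fin (suc n) → Code n
θ⁻¹ ε g = ε
θ⁻¹ (d ▸ r′) g = θ⁻¹ d r ▸ r
  where r = flipBelow g (opposite r′)

θ⁻¹-θ : ∀ {n} (c : Code n) g → θ⁻¹ (θ c g) g ≡ c
θ⁻¹-θ ε g = refl
θ⁻¹-θ (c ▸ r) g rewrite opposite-involutive (flipBelow g r) | flipBelow-involutive g r = cong (_▸ r) (θ⁻¹-θ c r)

θ-θ⁻¹ : ∀ {n} (d : Code n) g → θ (θ⁻¹ d g) g ≡ d
θ-θ⁻¹ ε g = refl
θ-θ⁻¹ (d ▸ r′) g = cong₂ _▸_ (θ-θ⁻¹ d _) (trans (cong opposite (flipBelow-involutive g (opposite r′))) (opposite-involutive r′))

Θ : ∀ {n} → Code n → Code n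
Θ ε = ε
Θ (c ▸ g) = θ c g ▸ g

Θ⁻¹ : ∀ {n} → Code n → Code n
Θ⁻¹ ε = ε
Θ⁻¹ (d ▸ g) = θ⁻¹ d g ▸ g

Θ↔ : ∀ {n} → Code n ↔ Code n
Θ↔ = mk↔ₛ′ Θ Θ⁻¹ Θ-Θ⁻¹ Θ⁻¹-Θ
  where
  Θ-Θ⁻¹ : ∀ {n} (d : Code n) → Θ (Θ⁻¹ d) ≡ d
  Θ-Θ⁻¹ ε = refl
  Θ-Θ⁻¹ (d ▸ g) = cong (_▸ g) (θ-θ⁻¹ d g)
  Θ⁻¹-Θ : ∀ {n} (c : Code n) → Θ⁻¹ (Θ c) ≡ c
  Θ⁻¹-Θ ε = refl
  Θ⁻¹-Θ (c ▸ g) = cong (_▸ g) (θ⁻¹-θ c g)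

invC-θ : ∀ {n} (c : Code n) g → invC (θ c g) + toℕ (opposite g) ≡ statC (c ▸ g)
invC-θ ε fzero = refl
invC-θ (c ▸ r) g = begin
  invC (θ c r) + toℕ (opposite (opposite (flipBelow g r))) + toℕ (opposite g)
    ≡⟨ cong (λ s → invC (θ c r) + toℕ s + toℕ (opposite g)) (opposite-involutive (flipBelow g r)) ⟩
  invC (θ c r) + toℕ (flipBelow g r) + toℕ (opposite g)
    ≡⟨ +-assoc (invC (θ c r)) _ _ ⟩
  invC (θ c r) + (toℕ (flipBelow g r) + toℕ (opposite g))
    ≡⟨ cong (invC (θ c r) +_) (flipBelow-statStep g r) ⟩
  invC (θ c r) + (toℕ (opposite r) + statStep r g)
    ≡⟨ +-assoc (invC (θ c r)) _ _ ⟨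
  invC (θ c r) + toℕ (opposite r) + statStep r g
    ≡⟨ cong (_+ statStep r g) (invC-θ c r) ⟩
  statC (c ▸ r) + statStep r g ∎
  where open ≡-Reasoning

invC-Θ : ∀ {n} (c : Code n) → invC (Θ c) ≡ statC c
invC-Θ ε = refl
invC-Θ (c ▸ g) = invC-θ c g

levelSet-↔ : ∀ {A B : Set} (e : A ↔ B) (f : A → ℕ) (h : B → ℕ) → (∀ a → h (Inverse.to e a) ≡ f a) →
             ∀ k → Σ A (λ a → f a ≡ k) ↔ Σ B (λ b → h b ≡ k)
levelSet-↔ e f h h∘e≗f k = Σ-↔ e (λ {a} →
  mk↔ₛ′ (trans (h∘e≗f a)) (trans (sym (h∘e≗f a))) (λ _ → ≡-irrelevant _ _) (λ _ → ≡-irrelevant _ _))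

theorem4 : (n : ℕ) → n ≥ 1 → (k : ℕ) →
           Σ (Perm n) (λ π → stat π ≡ k) ↔ Σ (Perm n) (λ π → inv π ≡ k)
theorem4 n _ = levelSet-↔ φ stat inv inv∘φ
  where
  φ : Perm n ↔ Perm n
  φ = ↔-trans Perm↔Code (↔-trans Θ↔ (↔-sym Perm↔Code))
  inv∘φ : ∀ π → inv (Inverse.to φ π) ≡ stat π
  inv∘φ π = begin
    invW (word (encode (Θ (decode π))))   ≡⟨ invW-encode (Θ (decode π)) ⟩
    invC (Θ (decode π))                   ≡⟨ invC-Θ (decode π) ⟩
    statC (decode π)                      ≡⟨ statW-encode (decode π) ⟨
    statW (word (encode (decode π)))      ≡⟨ cong (statW ∘ word) (encode-decode π) ⟩
    statW (word π)                        ∎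
    where open ≡-Reasoning
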